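{- Let $k\geq 2$, $r\geq 1$ and $0\leq\alpha<rk$ be integers, and let $m\in[1,k]$ be the integer with $(m-1)r\leq\alpha<mr$. If $\mathcal{A}$ is a finite sequence of positive integers with $k$ distinct terms each repeated exactly $r$ times, then \[|\Sigma_{\alpha}(r,\mathcal{A})|\geq r\left[\frac{k(k+1)}{2}-\frac{m(m+1)}{2}\right]+m(mr-\alpha)+1.\] If $\mathcal{A}$ is a finite sequence of nonnegative integers with $k$ distinct terms each repeated exactly $r$ times and $0\in\mathcal{A}$, then \[|\Sigma_{\alpha}(r,\mathcal{A})|\geq r\left[\frac{(k-1)k}{2}-\frac{(m-1)m}{2}\right]+(m-1)(mr-\alpha)+1.\] Both lower bounds are best possible, i.e., each is attained by some sequence of the respective kind.
   Context: For distinct integers $a_1,\ldots,a_k$ and $r\geq1$, $(a_1,\ldots,a_k)_r$ denotes the finite sequence consisting of $r$ copies of each $a_i$. For such a sequence $\mathcal{A}$ and an integer $0\leq\alpha\leq rk$, $\Sigma_{\alpha}(r,\mathcal{A})$ is the set of sums $s(\mathcal{B})$ of all terms of $\mathcal{B}$, over all subsequences $\mathcal{B}$ of $\mathcal{A}$ of length at least $\alpha$ (the empty subsequence has sum $0$). -}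

module Defs where

open import Data.Nat using (ℕ; _≤_)
open import Data.Integer using (ℤ; _+_; 0ℤ)
open import Data.Fin using (Fin)
open import Data.List using (List; length; foldr; concatMap; replicate; allFin)
open import Data.List.Relation.Binary.Sublist.Propositional using (_⊆_)
open import Data.List.Relation.Unary.All using (All)
open import Data.List.Relation.Unary.Unique.Propositional using (Unique)
open import Data.List.Membership.Propositional using (_∈_)
open import Data.Product using (Σ; ∃; _×_)
open import Relation.Binary.PropositionalEquality using (_≡_)
open import Function.Bundles using (_⇔_)

sumℤ : List ℤ → ℤ
sumℤ = foldr _+_ 0ℤ

rep : ∀ {k} → ℕ → (Fin k → ℤ) → List ℤ
rep {k} r a = concatMap (λ i → replicate r (a i)) (allFin k)

InΣ : ℕ → List ℤ → ℤ → Set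
InΣ α A s = Σ (List ℤ) λ B → B ⊆ A × α ≤ length B × sumℤ B ≡ s

CardAtLeast : ℕ → (ℤ → Set) → Set
CardAtLeast N P = Σ (List ℤ) λ L → Unique L × N ≤ length L × All P L

CardEq : ℕ → (ℤ → Set) → Set
CardEq N P = Σ (List ℤ) λ L → Unique L × length L ≡ N × (∀ s → P s ⇔ s ∈ L)

module Submission where

-- A subsequence of A = (a_1,...,a_k)_r is determined, up to order, by how
-- many copies cᵢ ≤ r of each aᵢ it uses, so Σ_α(r, A) is the set of weighted
-- sums Σ cᵢaᵢ with Σ cᵢ ≥ α (InΣ⇔Achievable).
--
-- Part one (lowerBound) is an induction on k around a largest term M.  With
-- T′ the full sum of the other terms, for each t ≤ r the k sums tM + T′ - d
-- (d = 0 or one other term) are achievable, distinct and lie in the interval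
-- ((t-1)M + T′, tM + T′] (module Blocks).  These blocks sit above the
-- sums given by the induction hypothesis, or, when α is in the top window,
-- above the single sum t₀M + T′.  Part two deletes the zero term, which takes
-- up r of the length (Achievable-zero⇔, zeroShift).  Part three: for
-- (k, ..., 1)_r every achievable sum lies in a window of exactly `bound`
-- integers (smallest-≤, window-size), which the sums of part one must then
-- fill (unique-covers); part four prepends the term 0.

open import Defs
open import Data.Nat using (ℕ; _+_; _*_; _∸_; _≤_; _<_)
open import Data.Nat.DivMod using (_/_)
open import Data.Integer using (ℤ; 0ℤ) renaming (_<_ to _<ℤ_; _≤_ to _≤ℤ_)
open import Data.Fin using (Fin)
open import Data.Product using (Σ; ∃; _×_)
open import Function.Definitions using (Injective)
open import Relation.Binary.PropositionalEquality using (_≡_)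

open import Data.Nat using (zero; suc; z≤n; s≤s)
import Data.Nat.Properties as NP
open import Data.Nat.DivMod using (m*n/n≡m)
import Data.Nat.Tactic.RingSolver as ℕ-Ring
open import Data.Integer using (+_; +≤+; +<+; -_; nonNegative) renaming (_+_ to _+ℤ_; _*_ to _*ℤ_; _-_ to _-ℤ_)
import Data.Integer.Properties as ZP
open import Data.Integer.Tactic.RingSolver using (solve-∀)
open import Data.Fin using (zero; suc; punchIn)
import Data.Fin.Properties as FinP
open import Data.Vec.Functional using (removeAt; insertAt)
  renaming (_∷_ to _◂_)
open import Data.Vec.Functional.Properties using (insertAt-lookup; removeAt-insertAt)
import Algebra.Properties.Semiring.Sum as SemiringSum
import Algebra.Properties.CommutativeMonoid.Sum as MonoidSum
open import Data.List using (List; []; _∷_; _++_; length; replicate; map; concat; allFin; applyUpTo; filter)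
import Data.List.Properties as LP
open import Data.List.Relation.Binary.Sublist.Propositional using (_⊆_; []; _∷_; _∷ʳ_)
import Data.List.Relation.Binary.Sublist.Propositional.Properties as SubP
open import Data.List.Relation.Unary.All as All using (All; []; _∷_)
import Data.List.Relation.Unary.All.Properties as AllP
open import Data.List.Relation.Unary.Any using (here; there)
import Data.List.Relation.Unary.Any as Any
open import Data.List.Relation.Unary.Unique.Propositional using (Unique)
open import Data.List.Relation.Unary.AllPairs using ([]; _∷_)
import Data.List.Relation.Unary.Unique.Propositional.Properties as UniqueP
open import Data.List.Relation.Binary.Disjoint.Propositional using (Disjoint)
open import Data.List.Membership.Propositional using (_∈_)
import Data.List.Membership.Propositional.Properties as MemP
open import Data.List.Membership.DecPropositional ZP._≟_ using (_∈?_)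
open import Data.Product using (_,_; proj₁; proj₂)
open import Data.Empty using (⊥; ⊥-elim)
open import Data.Sum using (inj₁; inj₂)
open import Function using (_∘_; id; _⇔_; mk⇔; Equivalence)
open import Relation.Nullary using (yes; no; ¬?)
open import Relation.Binary.PropositionalEquality using (refl; sym; trans; cong; cong₂; subst; module ≡-Reasoning)

module ℕ-Sum = SemiringSum NP.+-*-semiring
module ℤ-Sum = MonoidSum ZP.+-0-commutativeMonoid

Σℕ : ∀ {k} → (Fin k → ℕ) → ℕ
Σℕ = ℕ-Sum.sum

Σℤ : ∀ {k} → (Fin k → ℤ) → ℤ
Σℤ = ℤ-Sum.sum

Σℕ-const : ∀ k r → Σℕ {k} (λ _ → r) ≡ r * k
Σℕ-const zero r = sym (NP.*-zeroʳ r)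
Σℕ-const (suc k) r = trans (cong (_+_ r) (Σℕ-const k r)) (sym (NP.*-suc r k))

Σℕ-mono : ∀ {k} {f g : Fin k → ℕ} → (∀ i → f i ≤ g i) → Σℕ f ≤ Σℕ g
Σℕ-mono {zero} le = z≤n
Σℕ-mono {suc k} le = NP.+-mono-≤ (le zero) (Σℕ-mono (le ∘ suc))

Σℤ-mono : ∀ {k} {f g : Fin k → ℤ} → (∀ i → f i ≤ℤ g i) → Σℤ f ≤ℤ Σℤ g
Σℤ-mono {zero} le = ZP.≤-refl
Σℤ-mono {suc k} le = ZP.+-mono-≤ (le zero) (Σℤ-mono (le ∘ suc))

Σℤ-pos : ∀ {k} (f : Fin k → ℕ) → Σℤ (λ i → + f i) ≡ + Σℕ f
Σℤ-pos {zero} f = refl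
Σℤ-pos {suc k} f = trans (cong (+ f zero +ℤ_) (Σℤ-pos (f ∘ suc))) (sym (ZP.pos-+ (f zero) _))

-- A multiset drawn from (a_1,...,a_k)_r is described by a count vector c with
-- c i ≤ r copies of a i; its size is Σ c and its sum is the weighted sum of a by c.
weightedSum : ∀ {k} → (Fin k → ℤ) → (Fin k → ℕ) → ℤ
weightedSum a c = Σℤ (λ i → + c i *ℤ a i)

total : ∀ {k} → ℕ → (Fin k → ℤ) → ℤ
total r a = weightedSum a (λ _ → r)

Achievable : ∀ {k} → ℕ → ℕ → (Fin k → ℤ) → ℤ → Set
Achievable {k} r α a s = Σ (Fin k → ℕ) λ c → (∀ i → c i ≤ r) × α ≤ Σℕ c × weightedSum a c ≡ s

rep-suc : ∀ {k} r (a : Fin (suc k) → ℤ) → rep r a ≡ replicate r (a zero) ++ rep r (a ∘ suc)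
rep-suc r a = cong (replicate r (a zero) ++_)
  (cong concat (trans (LP.map-tabulate suc copies) (sym (LP.map-tabulate id (copies ∘ suc)))))
  where
  copies : Fin _ → List ℤ
  copies i = replicate r (a i)

sumℤ-++ : ∀ xs ys → sumℤ (xs ++ ys) ≡ sumℤ xs +ℤ sumℤ ys
sumℤ-++ [] ys = sym (ZP.+-identityˡ _)
sumℤ-++ (x ∷ xs) ys = trans (cong (x +ℤ_) (sumℤ-++ xs ys)) (sym (ZP.+-assoc x _ _))

sumℤ-replicate : ∀ u x → sumℤ (replicate u x) ≡ + u *ℤ x
sumℤ-replicate zero x = sym (ZP.*-zeroˡ x)
sumℤ-replicate (suc u) x = begin
  x +ℤ sumℤ (replicate u x)   ≡⟨ cong (x +ℤ_) (sumℤ-replicate u x) ⟩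
  x +ℤ + u *ℤ x               ≡⟨ cong (_+ℤ + u *ℤ x) (sym (ZP.*-identityˡ x)) ⟩
  + 1 *ℤ x +ℤ + u *ℤ x        ≡⟨ sym (ZP.*-distribʳ-+ x (+ 1) (+ u)) ⟩
  (+ 1 +ℤ + u) *ℤ x           ≡⟨ cong (_*ℤ x) (sym (ZP.pos-+ 1 u)) ⟩
  + suc u *ℤ x                ∎
  where open ≡-Reasoning

replicate-⊆ : ∀ {u n} (x : ℤ) → u ≤ n → replicate u x ⊆ replicate n x
replicate-⊆ {zero} {zero} x _ = []
replicate-⊆ {zero} {suc n} x _ = x ∷ʳ replicate-⊆ x z≤n
replicate-⊆ {suc u} {suc n} x (s≤s u≤n) = refl ∷ replicate-⊆ x u≤n

⊆-replicate : ∀ n (x : ℤ) {B} → B ⊆ replicate n x → B ≡ replicate (length B) x × length B ≤ n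
⊆-replicate zero x [] = refl , z≤n
⊆-replicate (suc n) x (.x ∷ʳ B⊆) with ⊆-replicate n x B⊆
... | B≡ , len = B≡ , NP.m≤n⇒m≤1+n len
⊆-replicate (suc n) x (refl ∷ B⊆) with ⊆-replicate n x B⊆
... | B≡ , len = cong (x ∷_) B≡ , s≤s len

⊆-++-split : ∀ (xs : List ℤ) {ys B} → B ⊆ xs ++ ys →
  Σ (List ℤ) λ B₁ → Σ (List ℤ) λ B₂ → B ≡ B₁ ++ B₂ × B₁ ⊆ xs × B₂ ⊆ ys
⊆-++-split [] B⊆ = [] , _ , refl , [] , B⊆
⊆-++-split (x ∷ xs) (.x ∷ʳ B⊆) with ⊆-++-split xs B⊆
... | B₁ , B₂ , B≡ , B₁⊆ , B₂⊆ = B₁ , B₂ , B≡ , x ∷ʳ B₁⊆ , B₂⊆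
⊆-++-split (x ∷ xs) (refl ∷ B⊆) with ⊆-++-split xs B⊆
... | B₁ , B₂ , B≡ , B₁⊆ , B₂⊆ = x ∷ B₁ , B₂ , cong (x ∷_) B≡ , refl ∷ B₁⊆ , B₂⊆

counts→sublist : ∀ {k} r (a : Fin k → ℤ) (c : Fin k → ℕ) → (∀ i → c i ≤ r) →
  Σ (List ℤ) λ B → B ⊆ rep r a × length B ≡ Σℕ c × sumℤ B ≡ weightedSum a c
counts→sublist {zero} r a c c≤r = [] , [] , refl , refl
counts→sublist {suc k} r a c c≤r with counts→sublist r (a ∘ suc) (c ∘ suc) (c≤r ∘ suc)
... | B , B⊆ , len , sum = replicate (c zero) (a zero) ++ B ,
  subst (_ ⊆_) (sym (rep-suc r a)) (SubP.++⁺ (replicate-⊆ (a zero) (c≤r zero)) B⊆) ,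
  trans (LP.length-++ (replicate (c zero) (a zero))) (cong₂ _+_ (LP.length-replicate (c zero)) len) ,
  trans (sumℤ-++ (replicate (c zero) (a zero)) B) (cong₂ _+ℤ_ (sumℤ-replicate (c zero) (a zero)) sum)

sublist→counts : ∀ {k} r (a : Fin k → ℤ) {B} → B ⊆ rep r a →
  Σ (Fin k → ℕ) λ c → (∀ i → c i ≤ r) × length B ≡ Σℕ c × sumℤ B ≡ weightedSum a c
sublist→counts {zero} r a [] = (λ ()) , (λ ()) , refl , refl
sublist→counts {suc k} r a B⊆
  with ⊆-++-split (replicate r (a zero)) (subst (_ ⊆_) (rep-suc r a) B⊆)
... | B₁ , B₂ , refl , B₁⊆ , B₂⊆ with ⊆-replicate r (a zero) B₁⊆ | sublist→counts r (a ∘ suc) B₂⊆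
...   | B₁≡ , u≤r | c , c≤r , len , sum = length B₁ ◂ c ,
  (λ { zero → u≤r ; (suc i) → c≤r i }) ,
  trans (LP.length-++ B₁) (cong (_+_ (length B₁)) len) ,
  trans (sumℤ-++ B₁ B₂) (cong₂ _+ℤ_ (trans (cong sumℤ B₁≡) (sumℤ-replicate (length B₁) (a zero))) sum)

InΣ⇔Achievable : ∀ {k} r α (a : Fin k → ℤ) s → InΣ α (rep r a) s ⇔ Achievable r α a s
InΣ⇔Achievable r α a s = mk⇔ to from
  where
  to : InΣ α (rep r a) s → Achievable r α a s
  to (B , B⊆ , α≤ , refl) with sublist→counts r a B⊆
  ... | c , c≤r , len , sum = c , c≤r , subst (α ≤_) len α≤ , sym sum
  from : Achievable r α a s → InΣ α (rep r a) s
  from (c , c≤r , α≤ , refl) with counts→sublist r a c c≤r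
  ... | B , B⊆ , len , sum = B , B⊆ , subst (α ≤_) (sym len) α≤ , sum

Σℕ-remove : ∀ {k} (c : Fin (suc k) → ℕ) j → Σℕ c ≡ c j + Σℕ (removeAt c j)
Σℕ-remove c j = ℕ-Sum.sum-remove {i = j} c

weightedSum-remove : ∀ {k} (a : Fin (suc k) → ℤ) (c : Fin (suc k) → ℕ) j →
  weightedSum a c ≡ + c j *ℤ a j +ℤ weightedSum (removeAt a j) (removeAt c j)
weightedSum-remove a c j = ℤ-Sum.sum-remove {i = j} (λ i → + c i *ℤ a i)

Σℕ-insert : ∀ {k} (c : Fin k → ℕ) j t → Σℕ (insertAt c j t) ≡ t + Σℕ c
Σℕ-insert c j t = trans (Σℕ-remove (insertAt c j t) j)
  (cong₂ _+_ (insertAt-lookup c j t) (ℕ-Sum.sum-cong-≗ (removeAt-insertAt c j t)))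

weightedSum-insert : ∀ {k} (a : Fin (suc k) → ℤ) (c : Fin k → ℕ) j t →
  weightedSum a (insertAt c j t) ≡ + t *ℤ a j +ℤ weightedSum (removeAt a j) c
weightedSum-insert a c j t = trans (weightedSum-remove a (insertAt c j t) j)
  (cong₂ (λ u w → + u *ℤ a j +ℤ w) (insertAt-lookup c j t)
    (ℤ-Sum.sum-cong-≗ λ p → cong (λ u → + u *ℤ a (punchIn j p)) (removeAt-insertAt c j t p)))

insertAt-bounded : ∀ {k r t} (c : Fin k → ℕ) j → t ≤ r → (∀ i → c i ≤ r) →
  ∀ i → insertAt c j t i ≤ r
insertAt-bounded c zero t≤r c≤r zero = t≤r
insertAt-bounded c zero t≤r c≤r (suc i) = c≤r i
insertAt-bounded {suc k} c (suc j) t≤r c≤r zero = c≤r zero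
insertAt-bounded {suc k} c (suc j) t≤r c≤r (suc i) = insertAt-bounded (c ∘ suc) j t≤r (c≤r ∘ suc) i

extend : ∀ {k r α β t s} (a : Fin (suc k) → ℤ) j → t ≤ r → α ≤ t + β →
  Achievable r β (removeAt a j) s → Achievable r α a (+ t *ℤ a j +ℤ s)
extend {α = α} {t = t} a j t≤r α≤ (c , c≤r , β≤ , refl) =
  insertAt c j t , insertAt-bounded c j t≤r c≤r ,
  subst (α ≤_) (sym (Σℕ-insert c j t)) (NP.≤-trans α≤ (NP.+-monoʳ-≤ t β≤)) ,
  weightedSum-insert a c j t

-- A term equal to 0 contributes nothing to the sum but can absorb up to r of
-- the required length.
Achievable-zero⇔ : ∀ {k} r α (a : Fin (suc k) → ℤ) j s → a j ≡ 0ℤ →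
  Achievable r α a s ⇔ Achievable r (α ∸ r) (removeAt a j) s
Achievable-zero⇔ r α a j s aj≡0 = mk⇔ to from
  where
  to : Achievable r α a s → Achievable r (α ∸ r) (removeAt a j) s
  to (c , c≤r , α≤ , refl) = removeAt c j , c≤r ∘ punchIn j ,
    NP.m≤n+o⇒m∸n≤o α r (NP.≤-trans α≤ (NP.≤-trans (NP.≤-reflexive (Σℕ-remove c j))
      (NP.+-monoˡ-≤ (Σℕ (removeAt c j)) (c≤r j)))) ,
    sym (begin
      weightedSum a c             ≡⟨ weightedSum-remove a c j ⟩
      + c j *ℤ a j +ℤ rest        ≡⟨ cong (λ x → + c j *ℤ x +ℤ rest) aj≡0 ⟩
      + c j *ℤ 0ℤ +ℤ rest         ≡⟨ cong (_+ℤ rest) (ZP.*-zeroʳ (+ c j)) ⟩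
      0ℤ +ℤ rest                  ≡⟨ ZP.+-identityˡ rest ⟩
      rest                        ∎)
    where
    open ≡-Reasoning
    rest : ℤ
    rest = weightedSum (removeAt a j) (removeAt c j)
  from : Achievable r (α ∸ r) (removeAt a j) s → Achievable r α a s
  from ach = subst (Achievable r α a) value (extend a j NP.≤-refl (NP.m≤n+m∸n α r) ach)
    where
    value : + r *ℤ a j +ℤ s ≡ s
    value = trans (cong (λ x → + r *ℤ x +ℤ s) aj≡0)
      (trans (cong (_+ℤ s) (ZP.*-zeroʳ (+ r))) (ZP.+-identityˡ s))

Achievable-≤-total : ∀ {k r α s} (a : Fin k → ℤ) → (∀ i → 0ℤ ≤ℤ a i) →
  Achievable r α a s → s ≤ℤ total r a
Achievable-≤-total a a≥0 (c , c≤r , _ , refl) =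
  Σℤ-mono λ i → ZP.*-monoʳ-≤-nonNeg (a i) {{nonNegative (a≥0 i)}} (+≤+ (c≤r i))

<-from-difference : ∀ {x y} d → 0ℤ <ℤ d → y ≡ x +ℤ d → x <ℤ y
<-from-difference {x} d 0<d refl = subst (_<ℤ x +ℤ d) (ZP.+-identityʳ x) (ZP.+-monoʳ-< x 0<d)

positive-difference : ∀ {d m} → d <ℤ m → 0ℤ <ℤ m -ℤ d
positive-difference {d} {m} d<m = subst (_<ℤ m -ℤ d) (ZP.+-inverseʳ d) (ZP.+-monoˡ-< (- d) d<m)

minus-injective : ∀ x {d e} → x -ℤ d ≡ x -ℤ e → d ≡ e
minus-injective x {d} {e} eq = begin
  d                  ≡⟨ cancel x d ⟩
  x -ℤ (x -ℤ d)      ≡⟨ cong (x -ℤ_) eq ⟩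
  x -ℤ (x -ℤ e)      ≡⟨ cancel x e ⟨
  e                  ∎
  where
  open ≡-Reasoning
  cancel : ∀ x d → d ≡ x -ℤ (x -ℤ d)
  cancel = solve-∀

separated-disjoint : ∀ {xs ys} c → All (_≤ℤ c) xs → All (c <ℤ_) ys → Disjoint xs ys
separated-disjoint c xs≤c c<ys (x∈xs , x∈ys) =
  ZP.<-irrefl refl (ZP.≤-<-trans (All.lookup xs≤c x∈xs) (All.lookup c<ys x∈ys))

argmax : ∀ {k} (a : Fin (suc k) → ℤ) → Σ (Fin (suc k)) λ j → ∀ i → a i ≤ℤ a j
argmax {zero} a = zero , λ { zero → ZP.≤-refl }
argmax {suc k} a with argmax (a ∘ suc)
... | j , a≤aj with a zero ZP.≤? a (suc j)
...   | yes a0≤aj = suc j , λ { zero → a0≤aj ; (suc i) → a≤aj i }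
...   | no a0≰aj = zero , λ { zero → ZP.≤-refl ; (suc i) → ZP.≤-trans (a≤aj i) (ZP.<⇒≤ (ZP.≰⇒> a0≰aj)) }

full : ∀ {k} r (a : Fin k → ℤ) → Achievable r (r * k) a (total r a)
full {k} r a = (λ _ → r) , (λ _ → NP.≤-refl) , NP.≤-reflexive (sym (Σℕ-const k r)) , refl

allButOne : ∀ {k} r (a : Fin k → ℤ) j → 1 ≤ r →
  Achievable r (r * k ∸ 1) a (total r a -ℤ a j)
allButOne {suc k} (suc r) a j _ = subst (Achievable (suc r) _ a) value
  (extend a j (NP.n≤1+n r) length≤ (full (suc r) (removeAt a j)))
  where
  length≤ : suc r * suc k ∸ 1 ≤ r + suc r * k
  length≤ = NP.≤-reflexive (cong (_∸ 1) (NP.*-suc (suc r) k))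
  value : + r *ℤ a j +ℤ total (suc r) (removeAt a j) ≡ total (suc r) a -ℤ a j
  value = begin
    + r *ℤ a j +ℤ U                       ≡⟨ drop-one (+ r) (a j) U ⟩
    ((+ 1 +ℤ + r) *ℤ a j +ℤ U) -ℤ a j     ≡⟨ cong (λ x → (x *ℤ a j +ℤ U) -ℤ a j) (sym (ZP.pos-+ 1 r)) ⟩
    (+ suc r *ℤ a j +ℤ U) -ℤ a j          ≡⟨ cong (_-ℤ a j) (weightedSum-remove a (λ _ → suc r) j) ⟨
    total (suc r) a -ℤ a j                ∎
    where
    open ≡-Reasoning
    U : ℤ
    U = total (suc r) (removeAt a j)
    drop-one : ∀ ρ x u → ρ *ℤ x +ℤ u ≡ ((+ 1 +ℤ ρ) *ℤ x +ℤ u) -ℤ x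
    drop-one = solve-∀

lift : ∀ {k r α s} (a : Fin (suc k) → ℤ) j → Achievable r α (removeAt a j) s → Achievable r α a s
lift {r = r} {α} {s} a j ach = subst (Achievable r α a) value (extend a j z≤n NP.≤-refl ach)
  where
  value : + 0 *ℤ a j +ℤ s ≡ s
  value = trans (cong (_+ℤ s) (ZP.*-zeroˡ (a j))) (ZP.+-identityˡ s)

-- With
-- T′ = s of the remaining terms taken r times, level t = tM + T′, and
-- block (t+1) consists of level (t+1) minus 0 or minus one remaining term:
-- k+1 distinct sums, all in the window (level t, level (t+1)].
module Blocks {k} (r : ℕ) (1≤r : 1 ≤ r) (a : Fin (suc k) → ℤ) (a-inj : Injective _≡_ _≡_ a)
  (a-pos : ∀ i → 0ℤ <ℤ a i) (j : Fin (suc k)) (a<aj : ∀ p → removeAt a j p <ℤ a j) where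

  M : ℤ
  M = a j

  a′ : Fin k → ℤ
  a′ = removeAt a j

  T′ : ℤ
  T′ = total r a′

  level : ℕ → ℤ
  level t = + t *ℤ M +ℤ T′

  level-suc : ∀ t → level (suc t) ≡ level t +ℤ M
  level-suc t = trans (cong (λ x → x *ℤ M +ℤ T′) (ZP.pos-+ 1 t)) (step (+ t) M T′)
    where
    step : ∀ τ m u → (+ 1 +ℤ τ) *ℤ m +ℤ u ≡ (τ *ℤ m +ℤ u) +ℤ m
    step = solve-∀

  level-< : ∀ t → level t <ℤ level (suc t)
  level-< t = <-from-difference M (a-pos j) (level-suc t)

  level-≤ : ∀ t d → level t ≤ℤ level (t + d)
  level-≤ t zero = ZP.≤-reflexive (cong level (sym (NP.+-identityʳ t)))
  level-≤ t (suc d) = ZP.≤-trans (level-≤ t d)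
    (ZP.≤-trans (ZP.<⇒≤ (level-< (t + d))) (ZP.≤-reflexive (cong level (sym (NP.+-suc t d)))))

  level-0 : level 0 ≡ T′
  level-0 = trans (cong (_+ℤ T′) (ZP.*-zeroˡ M)) (ZP.+-identityˡ T′)

  -- What may be left out of a full level: nothing, or one copy of one a′ p.
  drops : List ℤ
  drops = 0ℤ ∷ map a′ (allFin k)

  drops-length : length drops ≡ suc k
  drops-length = cong suc (trans (LP.length-map a′ (allFin k)) (LP.length-tabulate id))

  drops-range : All (λ d → 0ℤ ≤ℤ d × d <ℤ M) drops
  drops-range = (ZP.≤-refl , a-pos j) ∷ AllP.map⁺ (AllP.tabulate⁺ λ p → ZP.<⇒≤ (a-pos (punchIn j p)) , a<aj p)

  drops-unique : Unique drops
  drops-unique = AllP.map⁺ (AllP.tabulate⁺ λ p 0≡ → ZP.<-irrefl 0≡ (a-pos (punchIn j p)))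
    ∷ UniqueP.map⁺ (λ eq → FinP.punchIn-injective j _ _ (a-inj eq)) (UniqueP.allFin⁺ k)

  drops-achievable : All (λ d → Achievable r (r * k ∸ 1) a′ (T′ -ℤ d)) drops
  drops-achievable = subst (Achievable r (r * k ∸ 1) a′) (sym (ZP.+-identityʳ T′))
      (weaken (full r a′))
    ∷ AllP.map⁺ (AllP.tabulate⁺ λ p → allButOne r a′ p 1≤r)
    where
    weaken : ∀ {s} → Achievable r (r * k) a′ s → Achievable r (r * k ∸ 1) a′ s
    weaken (c , c≤r , len , sum) = c , c≤r , NP.≤-trans (NP.m∸n≤m (r * k) 1) len , sum

  block : ℕ → List ℤ
  block t = map (level t -ℤ_) drops

  block-length : ∀ t → length (block t) ≡ suc k
  block-length t = trans (LP.length-map _ drops) drops-length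

  block-unique : ∀ t → Unique (block t)
  block-unique t = UniqueP.map⁺ (minus-injective (level t)) drops-unique

  block-range : ∀ t → All (λ y → level t <ℤ y × y ≤ℤ level (suc t)) (block (suc t))
  block-range t = AllP.map⁺ (All.map window drops-range)
    where
    window : ∀ {d} → 0ℤ ≤ℤ d × d <ℤ M →
      level t <ℤ level (suc t) -ℤ d × level (suc t) -ℤ d ≤ℤ level (suc t)
    window {d} (0≤d , d<M) =
      <-from-difference (M -ℤ d) (positive-difference d<M) (trans (cong (_-ℤ d) (level-suc t)) (shift (level t) M d)) ,
      ZP.i-j≤i (level (suc t)) d {{nonNegative 0≤d}}
      where
      shift : ∀ x m d → (x +ℤ m) -ℤ d ≡ x +ℤ (m -ℤ d)
      shift = solve-∀

  block-achievable : ∀ {α} t → suc t ≤ r → α ≤ t + r * k → All (Achievable r α a) (block (suc t))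
  block-achievable {α} t t<r α≤ = AllP.map⁺ (All.map withLevel drops-achievable)
    where
    length≤ : α ≤ suc t + (r * k ∸ 1)
    length≤ = NP.≤-trans α≤ (NP.≤-trans (NP.+-monoʳ-≤ t (NP.m≤n+m∸n (r * k) 1))
      (NP.≤-reflexive (NP.+-suc t (r * k ∸ 1))))
    withLevel : ∀ {d} → Achievable r (r * k ∸ 1) a′ (T′ -ℤ d) → Achievable r α a (level (suc t) -ℤ d)
    withLevel {d} ach = subst (Achievable r α a) (regroup (+ suc t *ℤ M) T′ d) (extend a j t<r length≤ ach)
      where
      regroup : ∀ x y z → x +ℤ (y -ℤ z) ≡ (x +ℤ y) -ℤ z
      regroup = solve-∀

  blocks : ℕ → ℕ → List ℤ
  blocks t zero = []
  blocks t (suc u) = block (suc t) ++ blocks (suc t) u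

  blocks-length : ∀ t u → length (blocks t u) ≡ u * suc k
  blocks-length t zero = refl
  blocks-length t (suc u) =
    trans (LP.length-++ (block (suc t))) (cong₂ _+_ (block-length (suc t)) (blocks-length (suc t) u))

  blocks-range : ∀ t u → All (λ y → level t <ℤ y × y ≤ℤ level (t + u)) (blocks t u)
  blocks-range t zero = []
  blocks-range t (suc u) = AllP.++⁺
    (All.map (λ (above , below) → above , ZP.≤-trans below (top-≤ (level-≤ (suc t) u))) (block-range t))
    (All.map (λ (above , below) → ZP.<-trans (level-< t) above , top-≤ below) (blocks-range (suc t) u))
    where
    top-≤ : ∀ {y} → y ≤ℤ level (suc t + u) → y ≤ℤ level (t + suc u)
    top-≤ {y} = subst (λ n → y ≤ℤ level n) (sym (NP.+-suc t u))

  blocks-unique : ∀ t u → Unique (blocks t u)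
  blocks-unique t zero = []
  blocks-unique t (suc u) = UniqueP.++⁺ (block-unique (suc t)) (blocks-unique (suc t) u)
    (separated-disjoint (level (suc t)) (All.map proj₂ (block-range t)) (All.map proj₁ (blocks-range (suc t) u)))

  blocks-achievable : ∀ {α} t u → t + u ≤ r → α ≤ t + r * k → All (Achievable r α a) (blocks t u)
  blocks-achievable t zero _ _ = []
  blocks-achievable t (suc u) t+u≤r α≤ = AllP.++⁺
    (block-achievable t (NP.≤-trans (s≤s (NP.m≤m+n t u)) t+u≤r′) α≤)
    (blocks-achievable (suc t) u t+u≤r′ (NP.m≤n⇒m≤1+n α≤))
    where
    t+u≤r′ : suc t + u ≤ r
    t+u≤r′ = subst (_≤ r) (NP.+-suc t u) t+u≤r

  addBlocks : ∀ {α} t → t ≤ r → α ≤ t + r * k → (L : List ℤ) → Unique L →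
    All (Achievable r α a) L → All (_≤ℤ level t) L →
    CardAtLeast (length L + (r ∸ t) * suc k) (Achievable r α a)
  addBlocks t t≤r α≤ L L-unique L-ach L≤ =
    L ++ blocks t (r ∸ t) ,
    UniqueP.++⁺ L-unique (blocks-unique t (r ∸ t))
      (separated-disjoint (level t) L≤ (All.map proj₁ (blocks-range t (r ∸ t)))) ,
    NP.≤-reflexive (sym (trans (LP.length-++ L) (cong (_+_ (length L)) (blocks-length t (r ∸ t))))) ,
    AllP.++⁺ L-ach (blocks-achievable t (r ∸ t) (NP.≤-reflexive (NP.m+[n∸m]≡n t≤r)) α≤)

CardAtLeast-≤ : ∀ {N N′} {P : ℤ → Set} → N ≤ N′ → CardAtLeast N′ P → CardAtLeast N P
CardAtLeast-≤ N≤N′ (L , L-unique , N′≤ , L-P) = L , L-unique , NP.≤-trans N≤N′ N′≤ , L-P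

CardAtLeast-map : ∀ {N} {P Q : ℤ → Set} → (∀ {s} → P s → Q s) → CardAtLeast N P → CardAtLeast N Q
CardAtLeast-map P⇒Q (L , L-unique , N≤ , L-P) = L , L-unique , N≤ , All.map P⇒Q L-P

removeAt-injective : ∀ {k} (a : Fin (suc k) → ℤ) j → Injective _≡_ _≡_ a → Injective _≡_ _≡_ (removeAt a j)
removeAt-injective a j a-inj eq = FinP.punchIn-injective j _ _ (a-inj eq)

tri : ℕ → ℕ
tri zero = 0
tri (suc n) = suc n + tri n

-- tri is monotone, so tri k - tri m does not truncate when m ≤ k.
tri-mono : ∀ {m n} → m ≤ n → tri m ≤ tri n
tri-mono {zero} _ = z≤n
tri-mono {suc m} {suc n} (s≤s m≤n) = NP.+-mono-≤ (s≤s m≤n) (tri-mono m≤n)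

bound : ℕ → ℕ → ℕ → ℕ → ℕ
bound r k α m = r * (tri k ∸ tri m) + m * (m * r ∸ α) + 1

bound-step : ∀ r k α m → m ≤ k → bound r (suc k) α m ≡ bound r k α m + r * suc k
bound-step r k α m m≤k = begin
  r * (suc k + tri k ∸ tri m) + X + 1   ≡⟨ cong (λ d → r * d + X + 1) (NP.+-∸-assoc (suc k) (tri-mono m≤k)) ⟩
  r * (suc k + D) + X + 1               ≡⟨ regroup r (suc k) D X ⟩
  r * D + X + 1 + r * suc k             ∎
  where
  open ≡-Reasoning
  D = tri k ∸ tri m
  X = m * (m * r ∸ α)
  regroup : ∀ r K D X → r * (K + D) + X + 1 ≡ r * D + X + 1 + r * K
  regroup = ℕ-Ring.solve-∀

-- When α lies in the top window, m = k+1 and the bound counts r - t₀ blocks.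
bound-top : ∀ r k α → r * k ≤ α → bound r (suc k) α (suc k) ≡ 1 + (r ∸ (α ∸ r * k)) * suc k
bound-top r k α rk≤α = begin
  r * (tri (suc k) ∸ tri (suc k)) + suc k * (suc k * r ∸ α) + 1
    ≡⟨ cong₂ (λ d e → r * d + suc k * e + 1) (NP.n∸n≡0 (tri (suc k))) gap ⟩
  r * 0 + suc k * e + 1
    ≡⟨ regroup r k e ⟩
  1 + e * suc k ∎
  where
  open ≡-Reasoning
  e = r ∸ (α ∸ r * k)
  gap : suc k * r ∸ α ≡ e
  gap = begin
    suc k * r ∸ α                        ≡⟨ cong₂ _∸_ (trans (NP.+-comm r (k * r)) (cong (_+ r) (NP.*-comm k r)))
                                                      (sym (NP.m+[n∸m]≡n rk≤α)) ⟩
    (r * k + r) ∸ (r * k + (α ∸ r * k))  ≡⟨ NP.[m+n]∸[m+o]≡n∸o (r * k) r (α ∸ r * k) ⟩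
    e                                    ∎
  regroup : ∀ r k e → r * 0 + suc k * e + 1 ≡ 1 + e * suc k
  regroup = ℕ-Ring.solve-∀

module AroundLargest {k} (r : ℕ) (1≤r : 1 ≤ r) (a : Fin (suc k) → ℤ) (a-inj : Injective _≡_ _≡_ a)
  (a-pos : ∀ i → 0ℤ <ℤ a i) (j : Fin (suc k)) (a≤aj : ∀ i → a i ≤ℤ a j) where

  a<aj : ∀ p → removeAt a j p <ℤ a j
  a<aj p = ZP.≤∧≢⇒< (a≤aj (punchIn j p)) (λ eq → FinP.punchInᵢ≢i j p (a-inj eq))

  open Blocks r 1≤r a a-inj a-pos j a<aj

  -- α ≤ rk: the sums not using M, followed by r full blocks.
  belowTop : ∀ {α N} → α ≤ r * k → CardAtLeast N (Achievable r α a′) →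
    CardAtLeast (N + r * suc k) (Achievable r α a)
  belowTop {α} α≤rk (L , L-unique , N≤ , L-ach) =
    CardAtLeast-≤ (NP.+-monoˡ-≤ (r * suc k) N≤)
      (addBlocks 0 z≤n α≤rk L L-unique (All.map (lift a j) L-ach) (All.map belowLevel0 L-ach))
    where
    belowLevel0 : ∀ {s} → Achievable r α a′ s → s ≤ℤ level 0
    belowLevel0 ach = subst (_ ≤ℤ_) (sym level-0)
      (Achievable-≤-total a′ (λ p → ZP.<⇒≤ (a-pos (punchIn j p))) ach)

  -- rk ≤ α < r(k+1): level t₀ with t₀ = α - rk, followed by the r - t₀ blocks above it.
  inTop : ∀ {α} → r * k ≤ α → α < r + r * k →
    CardAtLeast (1 + (r ∸ (α ∸ r * k)) * suc k) (Achievable r α a)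
  inTop {α} rk≤α α<r+rk =
    addBlocks t₀ t₀≤r α≤ (level t₀ ∷ []) ([] ∷ [])
      (extend a j t₀≤r α≤ (full r a′) ∷ []) (ZP.≤-refl ∷ [])
    where
    t₀ = α ∸ r * k
    α≤ : α ≤ t₀ + r * k
    α≤ = NP.≤-reflexive (sym (NP.m∸n+n≡m rk≤α))
    t₀≤r : t₀ ≤ r
    t₀≤r = NP.m≤n+o⇒m∸n≤o α (r * k) (NP.≤-trans (NP.<⇒≤ α<r+rk) (NP.≤-reflexive (NP.+-comm r (r * k))))

lowerBound : ∀ k r α m (a : Fin k → ℤ) → Injective _≡_ _≡_ a → (∀ i → 0ℤ <ℤ a i) →
  1 ≤ r → 1 ≤ m → m ≤ k → (m ∸ 1) * r ≤ α → α < m * r →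
  CardAtLeast (bound r k α m) (Achievable r α a)
lowerBound zero r α zero a _ _ _ () _ _ _
lowerBound zero r α (suc m) a _ _ _ _ () _ _
lowerBound (suc k) r α m a a-inj a-pos 1≤r 1≤m m≤k+1 lo hi with argmax a | m NP.≤? k
... | j , a≤aj | yes m≤k =
  subst (λ N → CardAtLeast N (Achievable r α a)) (sym (bound-step r k α m m≤k))
    (belowTop (NP.≤-trans (NP.<⇒≤ hi) (NP.≤-trans (NP.*-monoˡ-≤ r m≤k) (NP.≤-reflexive (NP.*-comm k r))))
      (lowerBound k r α m (removeAt a j) (removeAt-injective a j a-inj) (a-pos ∘ punchIn j) 1≤r 1≤m m≤k lo hi))
  where open AroundLargest r 1≤r a a-inj a-pos j a≤aj
... | j , a≤aj | no m≰k with NP.≤-antisym m≤k+1 (NP.≰⇒> m≰k)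
...   | refl =
  subst (λ N → CardAtLeast N (Achievable r α a)) (sym (bound-top r k α rk≤α))
    (inTop rk≤α (subst (α <_) (cong (_+_ r) (NP.*-comm k r)) hi))
  where
  open AroundLargest r 1≤r a a-inj a-pos j a≤aj
  rk≤α : r * k ≤ α
  rk≤α = subst (_≤ α) (NP.*-comm k r) lo

zeroBound : ℕ → ℕ → ℕ → ℕ → ℕ
zeroBound r k α m = r * (tri k ∸ tri (m ∸ 1)) + (m ∸ 1) * (m * r ∸ α) + 1

-- Removing the zero term shifts (α, m) to (α - r, max(m - 1, 1)), turning the
-- bound for the k positive terms into zeroBound.
zeroShift : ∀ k r α m → 1 ≤ r → m ≤ suc (suc k) → (m ∸ 1) * r ≤ α → α < m * r →
  Σ ℕ λ m′ → 1 ≤ m′ × m′ ≤ suc k × (m′ ∸ 1) * r ≤ α ∸ r × α ∸ r < m′ * r ×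
    bound r (suc k) (α ∸ r) m′ ≡ zeroBound r (suc k) α m
zeroShift k r α zero 1≤r _ _ ()
zeroShift k r α (suc zero) 1≤r _ _ α<r =
  1 , s≤s z≤n , s≤s z≤n , z≤n ,
  subst (_< 1 * r) (sym α∸r≡0) (NP.≤-trans 1≤r (NP.≤-reflexive (sym (NP.*-identityˡ r)))) ,
  (begin
    r * (suc k + tri k ∸ 1) + 1 * (1 * r ∸ (α ∸ r)) + 1
      ≡⟨ cong (λ x → r * (k + tri k) + 1 * (1 * r ∸ x) + 1) α∸r≡0 ⟩
    r * (k + tri k) + 1 * (1 * r) + 1
      ≡⟨ regroup r (k + tri k) (1 * r ∸ α) ⟩
    r * (suc k + tri k) + 0 * (1 * r ∸ α) + 1 ∎)
  where
  open ≡-Reasoning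
  α∸r≡0 : α ∸ r ≡ 0
  α∸r≡0 = NP.m≤n⇒m∸n≡0 (NP.<⇒≤ (subst (α <_) (NP.*-identityˡ r) α<r))
  regroup : ∀ r t x → r * t + 1 * (1 * r) + 1 ≡ r * suc t + 0 * x + 1
  regroup = ℕ-Ring.solve-∀
zeroShift k r α (suc (suc m)) 1≤r m≤ lo hi =
  suc m , s≤s z≤n , NP.≤-pred m≤ , lo′ , hi′ , cong (λ x → r * (tri (suc k) ∸ tri (suc m)) + suc m * x + 1) gap
  where
  r≤α : r ≤ α
  r≤α = NP.≤-trans (NP.m≤m+n r (m * r)) lo
  lo′ : m * r ≤ α ∸ r
  lo′ = subst (_≤ α ∸ r) (NP.m+n∸m≡n r (m * r)) (NP.∸-monoˡ-≤ r lo)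
  hi′ : α ∸ r < suc m * r
  hi′ = subst (_≤ suc m * r) (NP.+-∸-assoc 1 r≤α) (NP.m≤n+o⇒m∸n≤o (suc α) r hi)
  gap : suc m * r ∸ (α ∸ r) ≡ suc (suc m) * r ∸ α
  gap = begin
    suc m * r ∸ (α ∸ r)              ≡⟨ NP.[m+n]∸[m+o]≡n∸o r (suc m * r) (α ∸ r) ⟨
    (r + suc m * r) ∸ (r + (α ∸ r))  ≡⟨ cong (r + suc m * r ∸_) (NP.m+[n∸m]≡n r≤α) ⟩
    suc (suc m) * r ∸ α              ∎
    where open ≡-Reasoning

lowerBoundWithZero : ∀ k r α m (a : Fin (suc (suc k)) → ℤ) → Injective _≡_ _≡_ a → (∀ i → 0ℤ ≤ℤ a i) →
  (∃ λ z → a z ≡ 0ℤ) → 1 ≤ r → 1 ≤ m → m ≤ suc (suc k) → (m ∸ 1) * r ≤ α → α < m * r →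
  CardAtLeast (zeroBound r (suc k) α m) (Achievable r α a)
lowerBoundWithZero k r α m a a-inj a≥0 (z , az≡0) 1≤r 1≤m m≤ lo hi with zeroShift k r α m 1≤r m≤ lo hi
... | m′ , 1≤m′ , m′≤ , lo′ , hi′ , bound≡ =
  subst (λ N → CardAtLeast N (Achievable r α a)) bound≡
    (CardAtLeast-map (Equivalence.from (Achievable-zero⇔ r α a z _ az≡0))
      (lowerBound (suc k) r (α ∸ r) m′ (removeAt a z) (removeAt-injective a z a-inj) positive
        1≤r 1≤m′ m′≤ lo′ hi′))
  where
  positive : ∀ p → 0ℤ <ℤ removeAt a z p
  positive p = ZP.≤∧≢⇒< (a≥0 (punchIn z p)) λ 0≡ → FinP.punchInᵢ≢i z p (a-inj (trans (sym 0≡) (sym az≡0)))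

withoutLength : ∀ {s} {K : List ℤ} → s ∈ K → length (filter (λ y → ¬? (s ZP.≟ y)) K) < length K
withoutLength {s} {K} s∈K = LP.filter-notAll (λ y → ¬? (s ZP.≟ y)) K (Any.map (λ s≡ s≢ → s≢ s≡) s∈K)

inWithout : ∀ {s x} {K : List ℤ} → x ∈ K → (s ≡ x → ⊥) → x ∈ filter (λ y → ¬? (s ZP.≟ y)) K
inWithout {s} x∈K s≢x = MemP.∈-filter⁺ (λ y → ¬? (s ZP.≟ y)) x∈K s≢x

unique-length-≤ : ∀ (L K : List ℤ) → Unique L → (∀ {x} → x ∈ L → x ∈ K) → length L ≤ length K
unique-length-≤ [] K _ _ = z≤n
unique-length-≤ (x ∷ L) K (x∉L ∷ L-unique) L⊆K = NP.≤-trans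
  (s≤s (unique-length-≤ L _ L-unique λ y∈L → inWithout (L⊆K (there y∈L)) (All.lookup x∉L y∈L)))
  (withoutLength (L⊆K (here refl)))

unique-covers : ∀ (L K : List ℤ) → Unique L → (∀ {x} → x ∈ L → x ∈ K) → length K ≤ length L →
  ∀ {s} → s ∈ K → s ∈ L
unique-covers L K L-unique L⊆K K≤L {s} s∈K with s ∈? L
... | yes s∈L = s∈L
... | no s∉L = ⊥-elim (NP.<-irrefl refl (NP.<-≤-trans
  (NP.≤-<-trans (unique-length-≤ L _ L-unique λ x∈L → inWithout (L⊆K x∈L) λ { refl → s∉L x∈L })
    (withoutLength s∈K))
  K≤L))

-- The extremal sequences: the terms k, k-1, ..., 1 (and, for part four, also 0).

descending : ∀ k → Fin k → ℕ
descending (suc k) zero = suc k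
descending (suc k) (suc i) = descending k i

descending-≤ : ∀ k i → descending k i ≤ k
descending-≤ (suc k) zero = NP.≤-refl
descending-≤ (suc k) (suc i) = NP.m≤n⇒m≤1+n (descending-≤ k i)

descending-injective : ∀ k → Injective _≡_ _≡_ (descending k)
descending-injective (suc k) {zero} {zero} _ = refl
descending-injective (suc k) {zero} {suc j} eq = ⊥-elim (NP.<-irrefl refl (subst (_≤ k) (sym eq) (descending-≤ k j)))
descending-injective (suc k) {suc i} {zero} eq = ⊥-elim (NP.<-irrefl refl (subst (_≤ k) eq (descending-≤ k i)))
descending-injective (suc k) {suc i} {suc j} eq = cong suc (descending-injective k eq)

descending-positive : ∀ k i → 0 < descending k i
descending-positive (suc k) zero = s≤s z≤n
descending-positive (suc k) (suc i) = descending-positive k i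

Σ-descending : ∀ k → Σℕ (descending k) ≡ tri k
Σ-descending zero = refl
Σ-descending (suc k) = cong (_+_ (suc k)) (Σ-descending k)

ι : ∀ {k} → (Fin k → ℕ) → Fin k → ℤ
ι w i = + w i

ι-descending-injective : ∀ k → Injective _≡_ _≡_ (ι (descending k))
ι-descending-injective k eq = descending-injective k (ZP.+-injective eq)

ι-descending-positive : ∀ k i → 0ℤ <ℤ ι (descending k) i
ι-descending-positive k i = +<+ (descending-positive k i)

weightedSum-ι : ∀ {k} (w c : Fin k → ℕ) → weightedSum (ι w) c ≡ + Σℕ (λ i → c i * w i)
weightedSum-ι w c = trans (ℤ-Sum.sum-cong-≗ λ i → sym (ZP.pos-* (c i) (w i))) (Σℤ-pos (λ i → c i * w i))

total-descending : ∀ r k → total r (ι (descending k)) ≡ + (r * tri k)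
total-descending r k = trans (weightedSum-ι (descending k) (λ _ → r))
  (cong +_ (trans (sym (ℕ-Sum.*-distribˡ-sum r (descending k))) (cong (_*_ r) (Σ-descending k))))

tri-pred : ∀ n → tri n ≡ n + tri (n ∸ 1)
tri-pred zero = refl
tri-pred (suc n) = refl

shortfall : ∀ k m → Σℕ (λ i → m ∸ descending k i) + tri (m ∸ suc k) ≡ tri (m ∸ 1)
shortfall zero m = refl
shortfall (suc k) m = begin
  (n + S) + tri (m ∸ suc (suc k))   ≡⟨ cong (λ x → n + S + tri x) one-less ⟨
  (n + S) + tri (n ∸ 1)             ≡⟨ regroup n S (tri (n ∸ 1)) ⟩
  S + (n + tri (n ∸ 1))             ≡⟨ cong (_+_ S) (sym (tri-pred n)) ⟩
  S + tri n                         ≡⟨ shortfall k m ⟩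
  tri (m ∸ 1)                       ∎
  where
  open ≡-Reasoning
  n = m ∸ suc k
  S = Σℕ (λ i → m ∸ descending k i)
  one-less : n ∸ 1 ≡ m ∸ suc (suc k)
  one-less = trans (NP.∸-+-assoc m (suc k) 1) (cong (m ∸_) (NP.+-comm (suc k) 1))
  regroup : ∀ n s t → n + s + t ≡ s + (n + t)
  regroup = ℕ-Ring.solve-∀

shortfall-≤ : ∀ k m → Σℕ (λ i → m ∸ descending k i) ≤ tri (m ∸ 1)
shortfall-≤ k m = NP.≤-trans (NP.m≤m+n _ _) (NP.≤-reflexive (shortfall k m))

copies-≤ : ∀ {r c} m w → c ≤ r → m * c ≤ c * w + r * (m ∸ w)
copies-≤ {r} {c} m w c≤r with NP.≤-total w m
... | inj₁ w≤m = begin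
  m * c                      ≡⟨ cong (_* c) (sym (NP.m+[n∸m]≡n w≤m)) ⟩
  (w + (m ∸ w)) * c          ≡⟨ NP.*-distribʳ-+ c w (m ∸ w) ⟩
  w * c + (m ∸ w) * c        ≤⟨ NP.+-mono-≤ (NP.≤-reflexive (NP.*-comm w c)) (NP.*-monoʳ-≤ (m ∸ w) c≤r) ⟩
  c * w + (m ∸ w) * r        ≡⟨ cong (_+_ (c * w)) (NP.*-comm (m ∸ w) r) ⟩
  c * w + r * (m ∸ w)        ∎
  where open NP.≤-Reasoning
... | inj₂ m≤w = NP.≤-trans (NP.≤-trans (NP.*-monoˡ-≤ c m≤w) (NP.≤-reflexive (NP.*-comm w c))) (NP.m≤m+n _ _)

tri-double : ∀ n → tri n * 2 ≡ n * suc n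
tri-double zero = refl
tri-double (suc n) = begin
  (suc n + tri n) * 2         ≡⟨ NP.*-distribʳ-+ 2 (suc n) (tri n) ⟩
  suc n * 2 + tri n * 2       ≡⟨ cong (_+_ (suc n * 2)) (tri-double n) ⟩
  suc n * 2 + n * suc n       ≡⟨ regroup n ⟩
  suc n * suc (suc n)         ∎
  where
  open ≡-Reasoning
  regroup : ∀ n → suc n * 2 + n * suc n ≡ suc n * suc (suc n)
  regroup = ℕ-Ring.solve-∀

-- The sum of the α smallest terms of (k, ..., 1)_r when (m-1)r ≤ α:
-- all r copies of 1, ..., m-1 and α - (m-1)r copies of m.
smallest : ℕ → ℕ → ℕ → ℕ
smallest r α m = r * tri (m ∸ 1) + m * (α ∸ (m ∸ 1) * r)

-- m·α = smallest + r·tri (m-1), since m(m-1) = 2·tri (m-1).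
smallest-identity : ∀ r α m → (m ∸ 1) * r ≤ α → m * α ≡ smallest r α m + r * tri (m ∸ 1)
smallest-identity r α zero _ = vanish r α (α ∸ 0)
  where
  vanish : ∀ r α x → 0 * α ≡ r * 0 + 0 * x + r * 0
  vanish = ℕ-Ring.solve-∀
smallest-identity r α (suc m) lo = begin
  suc m * α                               ≡⟨ cong (_*_ (suc m)) (sym (NP.m+[n∸m]≡n lo)) ⟩
  suc m * (m * r + e)                     ≡⟨ expand m r e ⟩
  (m * suc m) * r + suc m * e             ≡⟨ cong (λ x → x * r + suc m * e) (sym (tri-double m)) ⟩
  (tri m * 2) * r + suc m * e             ≡⟨ regroup (tri m) r (suc m * e) ⟩
  r * tri m + suc m * e + r * tri m       ∎
  where
  open ≡-Reasoning
  e = α ∸ m * r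
  expand : ∀ m r e → suc m * (m * r + e) ≡ (m * suc m) * r + suc m * e
  expand = ℕ-Ring.solve-∀
  regroup : ∀ t r x → (t * 2) * r + x ≡ r * t + x + r * t
  regroup = ℕ-Ring.solve-∀

-- Every sum of at least α terms of (k, ..., 1)_r is at least `smallest`:
-- with counts c, m·α ≤ Σ m·cᵢ ≤ Σ (cᵢ·wᵢ + r(m - wᵢ)) ≤ s + r·tri(m-1).
smallest-≤ : ∀ {k r α s} m → (m ∸ 1) * r ≤ α →
  Achievable r α (ι (descending k)) s → + smallest r α m ≤ℤ s
smallest-≤ {k} {r} {α} m lo (c , c≤r , α≤ , refl) =
  subst (+ smallest r α m ≤ℤ_) (sym (weightedSum-ι w c))
    (+≤+ (NP.+-cancelʳ-≤ (r * tri (m ∸ 1)) _ _ (begin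
      smallest r α m + r * tri (m ∸ 1)                 ≡⟨ smallest-identity r α m lo ⟨
      m * α                                            ≤⟨ NP.*-monoʳ-≤ m α≤ ⟩
      m * Σℕ c                                         ≡⟨ ℕ-Sum.*-distribˡ-sum m c ⟩
      Σℕ (λ i → m * c i)                               ≤⟨ Σℕ-mono (λ i → copies-≤ m (w i) (c≤r i)) ⟩
      Σℕ (λ i → c i * w i + r * (m ∸ w i))             ≡⟨ ℕ-Sum.∑-distrib-+ (λ i → c i * w i) shortᵣ ⟩
      W + Σℕ shortᵣ                                    ≡⟨ cong (_+_ W) (ℕ-Sum.*-distribˡ-sum r short) ⟨
      W + r * Σℕ short                                 ≤⟨ NP.+-monoʳ-≤ W (NP.*-monoʳ-≤ r (shortfall-≤ k m)) ⟩
      W + r * tri (m ∸ 1)                              ∎)))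
  where
  open NP.≤-Reasoning
  w = descending k
  W = Σℕ (λ i → c i * w i)
  short shortᵣ : Fin k → ℕ
  short i = m ∸ w i
  shortᵣ i = r * short i

window-size : ∀ r k α m → 1 ≤ m → m ≤ k → (m ∸ 1) * r ≤ α → α < m * r →
  smallest r α m + bound r k α m ≡ suc (r * tri k)
window-size r k α (suc m) _ m≤k lo hi = begin
  r * tri m + suc m * e + (r * D + suc m * (suc m * r ∸ α) + 1)
    ≡⟨ cong (λ x → r * tri m + suc m * e + (r * D + suc m * x + 1)) gap ⟩
  r * tri m + suc m * e + (r * D + suc m * (r ∸ e) + 1)
    ≡⟨ regroup r (tri m) (suc m) e (r ∸ e) D ⟩
  r * tri m + suc m * (e + (r ∸ e)) + r * D + 1
    ≡⟨ cong (λ x → r * tri m + suc m * x + r * D + 1) (NP.m+[n∸m]≡n e≤r) ⟩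
  r * tri m + suc m * r + r * D + 1
    ≡⟨ regroup′ r (tri m) m D ⟩
  suc (r * (tri (suc m) + D))
    ≡⟨ cong (λ x → suc (r * x)) (NP.m+[n∸m]≡n (tri-mono m≤k)) ⟩
  suc (r * tri k) ∎
  where
  open ≡-Reasoning
  e = α ∸ m * r
  D = tri k ∸ tri (suc m)
  e≤r : e ≤ r
  e≤r = NP.m≤n+o⇒m∸n≤o α (m * r) (NP.≤-trans (NP.<⇒≤ hi) (NP.≤-reflexive (NP.+-comm r (m * r))))
  gap : suc m * r ∸ α ≡ r ∸ e
  gap = begin
    (r + m * r) ∸ α               ≡⟨ cong₂ _∸_ (NP.+-comm r (m * r)) (sym (NP.m+[n∸m]≡n lo)) ⟩
    (m * r + r) ∸ (m * r + e)     ≡⟨ NP.[m+n]∸[m+o]≡n∸o (m * r) r e ⟩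
    r ∸ e                         ∎
  regroup : ∀ r t m e f D → r * t + m * e + (r * D + m * f + 1) ≡ r * t + m * (e + f) + r * D + 1
  regroup = ℕ-Ring.solve-∀
  regroup′ : ∀ r t m D → r * t + suc m * r + r * D + 1 ≡ suc (r * ((suc m + t) + D))
  regroup′ = ℕ-Ring.solve-∀

-- Part three in count-vector form: for (k, ..., 1)_r the achievable sums are
-- exactly the integers of the window [smallest, r·tri k]; the lower bound
-- supplies `bound` of them, which by counting must fill the whole window.
exactDescending : ∀ k r α m → 1 ≤ r → 1 ≤ m → m ≤ k → (m ∸ 1) * r ≤ α → α < m * r →
  CardEq (bound r k α m) (Achievable r α (ι (descending k)))
exactDescending k r α m 1≤r 1≤m m≤k lo hi =
  window , window-unique , LP.length-applyUpTo _ N , λ s → mk⇔ inWindow (fillsWindow s)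
  where
  a = ι (descending k)
  low = smallest r α m
  N = bound r k α m
  window : List ℤ
  window = applyUpTo (λ i → + (low + i)) N
  window-unique : Unique window
  window-unique = UniqueP.applyUpTo⁺₁ _ N λ i<j _ eq → NP.<-irrefl (NP.+-cancelˡ-≡ low _ _ (ZP.+-injective eq)) i<j
  between : ∀ {s} → + low ≤ℤ s → s ≤ℤ + (r * tri k) → s ∈ window
  between {+ v} (+≤+ low≤v) (+≤+ v≤top) =
    subst (_∈ window) (cong +_ (NP.m+[n∸m]≡n low≤v)) (MemP.∈-applyUpTo⁺ (λ i → + (low + i)) offset<N)
    where
    offset<N : v ∸ low < N
    offset<N = subst (_≤ N) (NP.+-∸-assoc 1 low≤v)
      (NP.m≤n+o⇒m∸n≤o (suc v) low (subst (suc v ≤_) (sym (window-size r k α m 1≤m m≤k lo hi)) (s≤s v≤top)))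
  inWindow : ∀ {s} → Achievable r α a s → s ∈ window
  inWindow ach = between (smallest-≤ m lo ach)
    (subst (_ ≤ℤ_) (total-descending r k) (Achievable-≤-total a (λ i → +≤+ z≤n) ach))
  fillsWindow : ∀ s → s ∈ window → Achievable r α a s
  fillsWindow s s∈window
    with lowerBound k r α m a (ι-descending-injective k) (ι-descending-positive k) 1≤r 1≤m m≤k lo hi
  ... | L , L-unique , N≤L , L-ach = All.lookup L-ach
    (unique-covers L window L-unique (λ x∈L → inWindow (All.lookup L-ach x∈L))
      (NP.≤-trans (NP.≤-reflexive (LP.length-applyUpTo _ N)) N≤L) s∈window)

withZero : ∀ k → Fin (suc k) → ℤ
withZero k = 0ℤ ◂ ι (descending k)

withZero-injective : ∀ k → Injective _≡_ _≡_ (withZero k)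
withZero-injective k {zero} {zero} _ = refl
withZero-injective k {zero} {suc j} eq = ⊥-elim (NP.<-irrefl (ZP.+-injective eq) (descending-positive k j))
withZero-injective k {suc i} {zero} eq = ⊥-elim (NP.<-irrefl (sym (ZP.+-injective eq)) (descending-positive k i))
withZero-injective k {suc i} {suc j} eq = cong suc (ι-descending-injective k eq)

withZero-nonnegative : ∀ k i → 0ℤ ≤ℤ withZero k i
withZero-nonnegative k zero = ZP.≤-refl
withZero-nonnegative k (suc i) = +≤+ z≤n

CardEq-resp : ∀ {N} {P Q : ℤ → Set} → (∀ s → P s ⇔ Q s) → CardEq N Q → CardEq N P
CardEq-resp P⇔Q (L , L-unique , len , Q⇔∈) = L , L-unique , len ,
  λ s → mk⇔ (Equivalence.to (Q⇔∈ s) ∘ Equivalence.to (P⇔Q s))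
             (Equivalence.from (P⇔Q s) ∘ Equivalence.from (Q⇔∈ s))

exactWithZero : ∀ k r α m → 1 ≤ r → m ≤ suc (suc k) → (m ∸ 1) * r ≤ α → α < m * r →
  CardEq (zeroBound r (suc k) α m) (Achievable r α (withZero (suc k)))
exactWithZero k r α m 1≤r m≤ lo hi with zeroShift k r α m 1≤r m≤ lo hi
... | m′ , 1≤m′ , m′≤ , lo′ , hi′ , bound≡ =
  subst (λ N → CardEq N (Achievable r α (withZero (suc k)))) bound≡
    (CardEq-resp (λ s → Achievable-zero⇔ r α (withZero (suc k)) zero s refl)
      (exactDescending (suc k) r (α ∸ r) m′ 1≤r 1≤m′ m′≤ lo′ hi′))

half : ∀ n → n * suc n / 2 ≡ tri n
half n = trans (cong (_/ 2) (sym (tri-double n))) (m*n/n≡m (tri n) 2)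

bound-closed : ∀ r k α m → r * (k * (k + 1) / 2 ∸ m * (m + 1) / 2) + m * (m * r ∸ α) + 1 ≡ bound r k α m
bound-closed r k α m = cong₂ (λ x y → r * (x ∸ y) + m * (m * r ∸ α) + 1) (half+1 k) (half+1 m)
  where
  half+1 : ∀ n → n * (n + 1) / 2 ≡ tri n
  half+1 n = trans (cong (λ x → n * x / 2) (NP.+-comm n 1)) (half n)

zeroBound-closed : ∀ r k α m → r * ((k ∸ 1) * k / 2 ∸ (m ∸ 1) * m / 2) + (m ∸ 1) * (m * r ∸ α) + 1 ≡
  zeroBound r (k ∸ 1) α m
zeroBound-closed r k α m = cong₂ (λ x y → r * (x ∸ y) + (m ∸ 1) * (m * r ∸ α) + 1) (half-pred k) (half-pred m)
  where
  half-pred : ∀ n → (n ∸ 1) * n / 2 ≡ tri (n ∸ 1)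
  half-pred zero = refl
  half-pred (suc n) = half n

toInΣ-atLeast : ∀ {k N N′} r α (a : Fin k → ℤ) → N′ ≡ N →
  CardAtLeast N (Achievable r α a) → CardAtLeast N′ (InΣ α (rep r a))
toInΣ-atLeast r α a refl = CardAtLeast-map (Equivalence.from (InΣ⇔Achievable r α a _))

toInΣ-exact : ∀ {k N N′} r α (a : Fin k → ℤ) → N′ ≡ N →
  CardEq N (Achievable r α a) → CardEq N′ (InΣ α (rep r a))
toInΣ-exact r α a refl = CardEq-resp (InΣ⇔Achievable r α a)

corollary3p3 : (k r α m : ℕ) → 2 ≤ k → 1 ≤ r → α < r * k →
  1 ≤ m → m ≤ k → (m ∸ 1) * r ≤ α → α < m * r →
  ((a : Fin k → ℤ) → Injective _≡_ _≡_ a → (∀ i → 0ℤ <ℤ a i) →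
    CardAtLeast (r * (k * (k + 1) / 2 ∸ m * (m + 1) / 2) + m * (m * r ∸ α) + 1)
      (InΣ α (rep r a)))
  × ((a : Fin k → ℤ) → Injective _≡_ _≡_ a → (∀ i → 0ℤ ≤ℤ a i) → (∃ λ i → a i ≡ 0ℤ) →
    CardAtLeast (r * ((k ∸ 1) * k / 2 ∸ (m ∸ 1) * m / 2) + (m ∸ 1) * (m * r ∸ α) + 1)
      (InΣ α (rep r a)))
  × (Σ (Fin k → ℤ) λ a → Injective _≡_ _≡_ a × (∀ i → 0ℤ <ℤ a i) ×
    CardEq (r * (k * (k + 1) / 2 ∸ m * (m + 1) / 2) + m * (m * r ∸ α) + 1)
      (InΣ α (rep r a)))
  × (Σ (Fin k → ℤ) λ a → Injective _≡_ _≡_ a × (∀ i → 0ℤ ≤ℤ a i) × (∃ λ i → a i ≡ 0ℤ) ×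
    CardEq (r * ((k ∸ 1) * k / 2 ∸ (m ∸ 1) * m / 2) + (m ∸ 1) * (m * r ∸ α) + 1)
      (InΣ α (rep r a)))
corollary3p3 (suc zero) _ _ _ (s≤s ()) _ _ _ _ _ _
corollary3p3 (suc (suc k)) r α m _ 1≤r _ 1≤m m≤k lo hi =
  (λ a a-inj a-pos → toInΣ-atLeast r α a (bound-closed r K α m)
    (lowerBound K r α m a a-inj a-pos 1≤r 1≤m m≤k lo hi)) ,
  (λ a a-inj a≥0 zero∈a → toInΣ-atLeast r α a (zeroBound-closed r K α m)
    (lowerBoundWithZero k r α m a a-inj a≥0 zero∈a 1≤r 1≤m m≤k lo hi)) ,
  (ι (descending K) , ι-descending-injective K , ι-descending-positive K ,
    toInΣ-exact r α _ (bound-closed r K α m) (exactDescending K r α m 1≤r 1≤m m≤k lo hi)) ,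
  (withZero (suc k) , withZero-injective (suc k) , withZero-nonnegative (suc k) , (zero , refl) ,
    toInΣ-exact r α _ (zeroBound-closed r K α m) (exactWithZero k r α m 1≤r m≤k lo hi))
  where
  K = suc (suc k)
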